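{- Let $S=(\mathcal{P},\mathcal{L})$ be a finite linear space and $G\leq \mathrm{Aut}(S)$. If $G$ has Property $(\star)$ (as a permutation group on $\mathcal{P}$) and $(S,G)$ is transverse, then $S$ is a refinement of $\mathcal{LS}(G)$.
   Context: A linear space $S=(\mathcal{P},\mathcal{L})$: lines are subsets of $\mathcal{P}$ and each pair of distinct points lies in exactly one line; $\mathrm{Aut}(S)$ is the group of permutations of $\mathcal{P}$ preserving $\mathcal{L}$. A permutation group $G$ on $\Omega$ has Property $(\star)$ if for all $u,v,w\in\Omega$ with $u\neq w$, $G_{uv}\leq G_w$ implies $G_{uw}\leq G_v$. For $u,v\in\Omega$, $\Lambda_{uv}=\{w\in\Omega:G_{uv}\leq G_w\}$, and $\mathcal{LS}(G)$ has point set $\Omega$ and line set $\{\Lambda_{uv}:u\neq v\}$. $(S,G)$ is transverse if for every flag $(u,\ell)$ (a point $u$ on a line $\ell$) and every orbit $\Delta$ of $G_u$ on $\mathcal{P}$, $|\ell\cap\Delta|\leq 1$. A linear space $S'=(\mathcal{P},\mathcal{L}')$ is a refinement of $S''=(\mathcal{P},\mathcal{L}'')$ if every line of $S'$ is contained in some line of $S''$. -}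

module Defs where

open import Data.Nat using (ℕ)
open import Data.Fin using (Fin)
open import Data.Fin.Subset using (Subset; _∈_)
open import Data.Fin.Permutation using (Permutation′; _⟨$⟩ʳ_; _⟨$⟩ˡ_; _≈_; id; flip; _∘ₚ_)
open import Data.Vec using (tabulate; lookup)
open import Data.Product using (Σ; ∃; _×_; _,_)
open import Function.Bundles using (_⇔_)
open import Relation.Binary.PropositionalEquality using (_≡_; _≢_)
open import Level using (suc; zero)

-- Points are Fin n (a finite point set).  A family of lines is a
-- predicate on subsets of the point set (a set of subsets).
LineSet : ℕ → Set₁
LineSet n = Subset n → Set

-- each pair of distinct points lies in exactly one line; as in the
-- standard definition of a linear space, every line has at least two
-- points
IsLinearSpace : {n : ℕ} → LineSet n → Set
IsLinearSpace {n} L =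
  ((ℓ : Subset n) → L ℓ → Σ (Fin n) λ a → Σ (Fin n) λ b → a ≢ b × a ∈ ℓ × b ∈ ℓ) ×
  ((u v : Fin n) → u ≢ v →
  Σ (Subset n) λ ℓ → (L ℓ × u ∈ ℓ × v ∈ ℓ) ×
    ((ℓ′ : Subset n) → L ℓ′ → u ∈ ℓ′ → v ∈ ℓ′ → ℓ′ ≡ ℓ))

-- image of a subset under a permutation: σ(ℓ) = { σ x : x ∈ ℓ }
image : {n : ℕ} → Permutation′ n → Subset n → Subset n
image σ ℓ = tabulate λ y → lookup ℓ (σ ⟨$⟩ˡ y)

IsAut : {n : ℕ} → LineSet n → Permutation′ n → Set
IsAut {n} L σ = (ℓ : Subset n) → L ℓ ⇔ L (image σ ℓ)

record IsPermGroup {n : ℕ} (G : Permutation′ n → Set) : Set where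
  field
    respects : ∀ {σ τ} → σ ≈ τ → G σ → G τ
    hasId    : G id
    closed∘  : ∀ {σ τ} → G σ → G τ → G (σ ∘ₚ τ)
    closed⁻¹ : ∀ {σ} → G σ → G (flip σ)

IsAutSubgroup : {n : ℕ} → LineSet n → (Permutation′ n → Set) → Set
IsAutSubgroup L G = IsPermGroup G × (∀ σ → G σ → IsAut L σ)

StabLe : {n : ℕ} → (Permutation′ n → Set) → Fin n → Fin n → Fin n → Set
StabLe {n} G u v w =
  (g : Permutation′ n) → G g → g ⟨$⟩ʳ u ≡ u → g ⟨$⟩ʳ v ≡ v → g ⟨$⟩ʳ w ≡ w

PropertyStar : {n : ℕ} → (Permutation′ n → Set) → Set
PropertyStar {n} G = (u v w : Fin n) → u ≢ w → StabLe G u v w → StabLe G u w v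

Λ : {n : ℕ} → (Permutation′ n → Set) → Fin n → Fin n → Fin n → Set
Λ G u v w = StabLe G u v w

SameOrbitStab : {n : ℕ} → (Permutation′ n → Set) → Fin n → Fin n → Fin n → Set
SameOrbitStab {n} G u x y = Σ (Permutation′ n) λ g → G g × g ⟨$⟩ʳ u ≡ u × g ⟨$⟩ʳ x ≡ y

-- (S,G) transverse: for every flag (u,ℓ) and every G_u-orbit Δ,
-- |ℓ ∩ Δ| ≤ 1, i.e. two points of ℓ in a common G_u-orbit coincide
Transverse : {n : ℕ} → LineSet n → (Permutation′ n → Set) → Set
Transverse {n} L G =
  (u : Fin n) (ℓ : Subset n) → L ℓ → u ∈ ℓ →
  (x y : Fin n) → x ∈ ℓ → y ∈ ℓ → SameOrbitStab G u x y → x ≡ y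

RefinesLS : {n : ℕ} → LineSet n → (Permutation′ n → Set) → Set
RefinesLS {n} L G =
  (ℓ : Subset n) → L ℓ →
  Σ (Fin n) λ u → Σ (Fin n) λ v → u ≢ v × ((x : Fin n) → x ∈ ℓ → Λ G u v x)

{-# OPTIONS --safe #-}
module Submission where

-- An element g of G fixing two distinct points u, v of a line ℓ maps ℓ to a
-- line through u and v, hence to ℓ itself. So for x ∈ ℓ, both x and g x lie
-- on ℓ and in the same G_u-orbit, and transversality forces g x = x: every
-- line through u and v lies in Λ_{uv}.

open import Defs
open import Data.Nat using (ℕ)
open import Data.Fin using (Fin)
open import Data.Fin.Subset using (Subset; _∈_)
open import Data.Fin.Permutation using (Permutation′; _⟨$⟩ʳ_; _⟨$⟩ˡ_; inverseˡ)
open import Data.Vec using (lookup)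
open import Data.Vec.Properties using ([]=⇒lookup; lookup⇒[]=; lookup∘tabulate)
open import Data.Product using (_,_; proj₁; proj₂)
open import Function.Bundles using (Equivalence)
open import Relation.Binary.PropositionalEquality using (_≡_; _≢_; refl; sym; trans; cong; subst; module ≡-Reasoning)

private
  variable
    n : ℕ

∈-image⁺ : (g : Permutation′ n) {ℓ : Subset n} {x : Fin n} →
  x ∈ ℓ → g ⟨$⟩ʳ x ∈ image g ℓ
∈-image⁺ g {ℓ} {x} x∈ℓ = lookup⇒[]= (g ⟨$⟩ʳ x) _ (begin
  lookup (image g ℓ) (g ⟨$⟩ʳ x) ≡⟨ lookup∘tabulate _ (g ⟨$⟩ʳ x) ⟩
  lookup ℓ (g ⟨$⟩ˡ (g ⟨$⟩ʳ x))   ≡⟨ cong (lookup ℓ) (inverseˡ g) ⟩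
  lookup ℓ x                     ≡⟨ []=⇒lookup x∈ℓ ⟩
  _                              ∎)
  where open ≡-Reasoning

fixed-∈-image⁺ : (g : Permutation′ n) {ℓ : Subset n} {u : Fin n} →
  g ⟨$⟩ʳ u ≡ u → u ∈ ℓ → u ∈ image g ℓ
fixed-∈-image⁺ g {ℓ} gu≡u u∈ℓ = subst (_∈ image g ℓ) gu≡u (∈-image⁺ g u∈ℓ)

module _ {L : LineSet n} (linear : IsLinearSpace L) where

  lines-through-two-points-equal : {u v : Fin n} → u ≢ v →
    {ℓ ℓ′ : Subset n} → L ℓ → u ∈ ℓ → v ∈ ℓ → L ℓ′ → u ∈ ℓ′ → v ∈ ℓ′ → ℓ′ ≡ ℓ
  lines-through-two-points-equal u≢v Lℓ u∈ℓ v∈ℓ Lℓ′ u∈ℓ′ v∈ℓ′ =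
    trans (unique _ Lℓ′ u∈ℓ′ v∈ℓ′) (sym (unique _ Lℓ u∈ℓ v∈ℓ))
    where unique = proj₂ (proj₂ (proj₂ linear _ _ u≢v))

  aut-fixing-two-points-preserves-line : {g : Permutation′ n} → IsAut L g →
    {u v : Fin n} → u ≢ v → g ⟨$⟩ʳ u ≡ u → g ⟨$⟩ʳ v ≡ v →
    {ℓ : Subset n} → L ℓ → u ∈ ℓ → v ∈ ℓ →
    {x : Fin n} → x ∈ ℓ → g ⟨$⟩ʳ x ∈ ℓ
  aut-fixing-two-points-preserves-line {g} aut u≢v gu≡u gv≡v {ℓ} Lℓ u∈ℓ v∈ℓ {x} x∈ℓ =
    subst (λ m → g ⟨$⟩ʳ x ∈ m) gℓ≡ℓ (∈-image⁺ g x∈ℓ)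
    where
    gℓ≡ℓ : image g ℓ ≡ ℓ
    gℓ≡ℓ = lines-through-two-points-equal u≢v Lℓ u∈ℓ v∈ℓ
      (Equivalence.to (aut ℓ) Lℓ) (fixed-∈-image⁺ g gu≡u u∈ℓ) (fixed-∈-image⁺ g gv≡v v∈ℓ)

  line⊆Λ : {G : Permutation′ n → Set} → (∀ g → G g → IsAut L g) → Transverse L G →
    {u v : Fin n} → u ≢ v → {ℓ : Subset n} → L ℓ → u ∈ ℓ → v ∈ ℓ →
    (x : Fin n) → x ∈ ℓ → Λ G u v x
  line⊆Λ aut transverse {u} u≢v {ℓ} Lℓ u∈ℓ v∈ℓ x x∈ℓ g Gg gu≡u gv≡v =
    sym (transverse u ℓ Lℓ u∈ℓ x (g ⟨$⟩ʳ x) x∈ℓ gx∈ℓ (g , Gg , gu≡u , refl))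
    where
    gx∈ℓ : g ⟨$⟩ʳ x ∈ ℓ
    gx∈ℓ = aut-fixing-two-points-preserves-line {g} (aut g Gg) u≢v gu≡u gv≡v Lℓ u∈ℓ v∈ℓ x∈ℓ

proposition3p4 : (n : ℕ) (L : LineSet n) (G : Permutation′ n → Set) →
    IsLinearSpace L → IsAutSubgroup L G →
    PropertyStar G → Transverse L G →
    RefinesLS L G
proposition3p4 n L G linear (_ , aut) _ transverse ℓ Lℓ
  with proj₁ linear ℓ Lℓ
... | u , v , u≢v , u∈ℓ , v∈ℓ = u , v , u≢v , line⊆Λ linear aut transverse u≢v Lℓ u∈ℓ v∈ℓ
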